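{- Let $\mathbf{K}$ be an order-enriched category with arbitrary non-empty joins which is left distributive, $J$-left distributive and $J$-right distributive, where $J\colon\mathbf{J}\to\mathbf{K}$ exhibits a wide subcategory, and let $q\colon M\to N$ be a surjective monoid homomorphism. Let $\pi,\pi'\in[\mathbf{M},\mathbf{K}]^J$ and let $f\colon\pi\to\pi'$ be a morphism which is a natural transformation, i.e. $J(f)\circ\pi_m=\pi'_m\circ J(f)$ for all $m\in M$. Then $f$ is a natural transformation $\Sigma_q(\pi)\to\Sigma_q(\pi')$, i.e. $J(f)\circ\Sigma_q(\pi)_n=\Sigma_q(\pi')_n\circ J(f)$ for all $n\in N$.
   Context: Order-enriched: hom-sets partially ordered, composition monotone; arbitrary non-empty joins: hom-posets have suprema of non-empty subsets. Left distributive: $g\circ(\bigvee_i g_i)=\bigvee_i g\circ g_i$ for all $g$. $J$-left distributive: $f\circ(\bigvee_i g_i)=\bigvee_i f\circ g_i$ for $f$ in the image of $J$; $J$-right distributive: $(\bigvee_i g_i)\circ f=\bigvee_i g_i\circ f$ for $f$ in the image of $J$ (non-empty families). A monoid is viewed as a one-object category; a lax functor $\pi$ from $\mathbf{M}$ to $\mathbf{K}$ is an object $\pi(\ast)$ with endomorphisms $\pi_m$, $id\leq\pi_1$, $\pi_m\circ\pi_{m'}\leq\pi_{mm'}$. $[\mathbf{M},\mathbf{K}]^J$: morphisms $\pi\to\pi'$ are $f\colon\pi(\ast)\to\pi'(\ast)$ in $\mathbf{J}$ with $J(f)\circ\pi_m\leq\pi'_m\circ J(f)$. $\Sigma_q(\pi)(\ast)=\pi(\ast)$,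 $\Sigma_q(\pi)_n=\bigvee_{i<\omega}\Pi_{n,i}$, $\Pi_{n,0}=\bigvee\{\pi_m\mid q(m)=n\}$, $\Pi_{n,i+1}=\bigvee\{\Pi_{n_1,i}\circ\cdots\circ\Pi_{n_l,i}\mid l\ge1,\ n_1\cdots n_l=n\}$. -}

module Defs where

open import Level using (Level; _⊔_; suc; Lift; lift)
open import Data.Nat using (ℕ)
open import Data.Product using (Σ; _,_)
open import Data.List.NonEmpty using (List⁺; _∷_; foldr₁)
open import Data.List using (List; []; _∷_)
open import Relation.Binary.PropositionalEquality using (_≡_; refl)
open import Relation.Binary.Structures using (IsPartialOrder)
open import Algebra.Structures using (IsMonoid)

record OrderCat (o h r ι : Level) : Set (Level.suc (o ⊔ h ⊔ r ⊔ ι)) where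
  infixr 9 _∘_
  infix 4 _≤_
  field
    Obj  : Set o
    Hom  : Obj → Obj → Set h
    id   : ∀ {A} → Hom A A
    _∘_  : ∀ {A B C} → Hom B C → Hom A B → Hom A C
    assoc : ∀ {A B C D} (f : Hom C D) (g : Hom B C) (k : Hom A B) →
            (f ∘ g) ∘ k ≡ f ∘ (g ∘ k)
    identityˡ : ∀ {A B} (f : Hom A B) → id ∘ f ≡ f
    identityʳ : ∀ {A B} (f : Hom A B) → f ∘ id ≡ f
    _≤_  : ∀ {A B} → Hom A B → Hom A B → Set r
    ≤-isPartialOrder : ∀ {A B} → IsPartialOrder (_≡_ {A = Hom A B}) _≤_
    ∘-mono : ∀ {A B C} {f f' : Hom B C} {g g' : Hom A B} →
             f ≤ f' → g ≤ g' → f ∘ g ≤ f' ∘ g'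
    -- joins of non-empty families (non-emptiness witnessed by i₀)
    ⋁     : ∀ {A B} {I : Set ι} → I → (I → Hom A B) → Hom A B
    ⋁-ub  : ∀ {A B} {I : Set ι} (i₀ : I) (g : I → Hom A B) (i : I) →
            g i ≤ ⋁ i₀ g
    ⋁-lub : ∀ {A B} {I : Set ι} (i₀ : I) (g : I → Hom A B) (k : Hom A B) →
            (∀ i → g i ≤ k) → ⋁ i₀ g ≤ k

module _ {o h r ι : Level} (K : OrderCat o h r ι) where
  open OrderCat K

  LeftDistributive : Set (o ⊔ h ⊔ Level.suc ι)
  LeftDistributive = ∀ {A B C} {I : Set ι} (g : Hom B C) (i₀ : I) (gs : I → Hom A B) →
    g ∘ ⋁ i₀ gs ≡ ⋁ i₀ (λ i → g ∘ gs i)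

  -- A wide subcategory J of K, given by the morphisms in the image of J
  -- (all objects, closed under identities and composition).
  record WideSubcategory (j : Level) : Set (o ⊔ h ⊔ Level.suc j) where
    field
      InJ    : ∀ {A B} → Hom A B → Set j
      id-InJ : ∀ {A} → InJ (id {A})
      ∘-InJ  : ∀ {A B C} {f : Hom B C} {g : Hom A B} → InJ f → InJ g → InJ (f ∘ g)

  module _ {j : Level} (J : WideSubcategory j) where
    open WideSubcategory J

    JLeftDistributive : Set (o ⊔ h ⊔ Level.suc ι ⊔ j)
    JLeftDistributive = ∀ {A B C} {I : Set ι} (f : Hom B C) → InJ f →
      (i₀ : I) (gs : I → Hom A B) → f ∘ ⋁ i₀ gs ≡ ⋁ i₀ (λ i → f ∘ gs i)

    JRightDistributive : Set (o ⊔ h ⊔ Level.suc ι ⊔ j)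
    JRightDistributive = ∀ {A B C} {I : Set ι} (f : Hom A B) → InJ f →
      (i₀ : I) (gs : I → Hom B C) → ⋁ i₀ gs ∘ f ≡ ⋁ i₀ (λ i → gs i ∘ f)

record Mon (ι : Level) : Set (Level.suc ι) where
  infixl 7 _∙_
  field
    Carrier  : Set ι
    _∙_      : Carrier → Carrier → Carrier
    ε        : Carrier
    isMonoid : IsMonoid _≡_ _∙_ ε

record IsMonoidHom {ι : Level} (M N : Mon ι) (q : Mon.Carrier M → Mon.Carrier N) : Set ι where
  field
    ε-homo : q (Mon.ε M) ≡ Mon.ε N
    ∙-homo : ∀ x y → q (Mon._∙_ M x y) ≡ Mon._∙_ N (q x) (q y)

Surjective : ∀ {a b} {A : Set a} {B : Set b} → (A → B) → Set (a ⊔ b)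
Surjective {A = A} q = ∀ y → Σ A (λ x → q x ≡ y)

-- Lax functors from a monoid (one-object category) to K

module _ {o h r ι : Level} (K : OrderCat o h r ι) (M : Mon ι) where
  open OrderCat K
  open Mon M

  record LaxFunctor : Set (o ⊔ h ⊔ r ⊔ ι) where
    field
      obj      : Obj
      act      : Carrier → Hom obj obj
      lax-unit : id ≤ act ε
      lax-comp : ∀ m m' → act m ∘ act m' ≤ act (m ∙ m')

module _ {o h r ι : Level} (K : OrderCat o h r ι) {M N : Mon ι}
         (q : Mon.Carrier M → Mon.Carrier N) (surj : Surjective q) where
  open OrderCat K
  private
    module N = Mon N

  composeFrom : ∀ {A} → (N.Carrier → Hom A A) → N.Carrier → List N.Carrier → Hom A A
  composeFrom P n []       = P n
  composeFrom P n (m ∷ ms) = P n ∘ composeFrom P m ms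

  composeList : ∀ {A} → (N.Carrier → Hom A A) → List⁺ N.Carrier → Hom A A
  composeList P (n ∷ ns) = composeFrom P n ns

  prod⁺ : List⁺ N.Carrier → N.Carrier
  prod⁺ = foldr₁ N._∙_

  module _ (π : LaxFunctor K M) where
    open LaxFunctor π

    Π : ℕ → N.Carrier → Hom obj obj
    Π ℕ.zero n    = ⋁ (surj n) (λ (p : Σ (Mon.Carrier M) (λ m → q m ≡ n)) →
                                   act (Data.Product.proj₁ p))
    Π (ℕ.suc i) n = ⋁ ((n ∷ []) , refl)
                      (λ (p : Σ (List⁺ N.Carrier) (λ ns → prod⁺ ns ≡ n)) →
                         composeList (Π i) (Data.Product.proj₁ p))

    -- Σ_q(π)_n = ⋁_{i<ω} Π_{n,i}   (Σ_q(π)(∗) = π(∗) = obj)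
    Σq : N.Carrier → Hom obj obj
    Σq n = ⋁ (lift 0) (λ (k : Lift ι ℕ) → Π (Level.lower k) n)

module Submission where

-- Fix a morphism f : A → B lying in the wide subcategory J.  Say
-- that endomorphisms P : A → A and P' : B → B are *intertwined by f* when
-- f ∘ P ≡ P' ∘ f.  Intertwining is preserved by
--   * joins: if f ∘ Pᵢ ≡ P'ᵢ ∘ f for all i, then f ∘ ⋁ Pᵢ ≡ (⋁ P'ᵢ) ∘ f,
--     by J-left distributivity, then pointwise rewriting, then
--     J-right distributivity;
--   * composition: intertwined pairs compose to intertwined pairs.
-- Every Σ_q(π)_n is built from the π_m by exactly these two operations:
-- Π_{n,0} is a join of π_m's, Π_{n,i+1} is a join of composites of Π_{-,i}'s,
-- and Σ_q(π)_n is a join of the Π_{n,i}.  So naturality of f with respect to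
-- the π_m propagates, by induction on i, to the Π_{n,i} and then to Σ_q(π)_n.

open import Defs
open import Level using (Level; lower)
open import Relation.Binary.PropositionalEquality
  using (_≡_; sym; cong; module ≡-Reasoning)
open import Relation.Binary.Structures using (IsPartialOrder)
open import Data.Nat using (zero; suc)
open import Data.Product using (_,_)
open import Data.List using ([]; _∷_)
open import Data.List.NonEmpty using (_∷_)

module JoinProperties {o h r ι : Level} (K : OrderCat o h r ι) where
  open OrderCat K

  ⋁-cong : ∀ {A B : Obj} {I : Set ι} (i₀ : I) {g g' : I → Hom A B} →
           (∀ i → g i ≡ g' i) → ⋁ i₀ g ≡ ⋁ i₀ g'
  ⋁-cong {A} {B} {I} i₀ {g} {g'} g≡g' = antisym
    (⋁-lub i₀ g (⋁ i₀ g') (below g≡g'))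
    (⋁-lub i₀ g' (⋁ i₀ g) (below (λ i → sym (g≡g' i))))
    where
      open IsPartialOrder (≤-isPartialOrder {A} {B})
        using (antisym; reflexive) renaming (trans to ≤-trans)
      below : ∀ {u v : I → Hom A B} → (∀ i → u i ≡ v i) → ∀ i → u i ≤ ⋁ i₀ v
      below {u} {v} u≡v i = ≤-trans (reflexive (u≡v i)) (⋁-ub i₀ v i)

module Intertwining {o h r ι j : Level} (K : OrderCat o h r ι)
                    (J : WideSubcategory K j)
                    (JL : JLeftDistributive K J) (JR : JRightDistributive K J)
                    {A B : OrderCat.Obj K} (f : OrderCat.Hom K A B)
                    (f∈J : WideSubcategory.InJ J f) where
  open OrderCat K
  open JoinProperties K
  open ≡-Reasoning

  Intertwined : Hom A A → Hom B B → Set h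
  Intertwined P P' = f ∘ P ≡ P' ∘ f

  -- Intertwining is preserved by non-empty joins, since f ∈ J lets us
  -- distribute over the join on both sides.
  ⋁-intertwined : ∀ {I : Set ι} (i₀ : I) {P : I → Hom A A} {P' : I → Hom B B} →
                  (∀ i → Intertwined (P i) (P' i)) → Intertwined (⋁ i₀ P) (⋁ i₀ P')
  ⋁-intertwined i₀ {P} {P'} nat = begin
    f ∘ ⋁ i₀ P               ≡⟨ JL f f∈J i₀ P ⟩
    ⋁ i₀ (λ i → f ∘ P i)     ≡⟨ ⋁-cong i₀ nat ⟩
    ⋁ i₀ (λ i → P' i ∘ f)    ≡⟨ sym (JR f f∈J i₀ P') ⟩
    ⋁ i₀ P' ∘ f              ∎

  ∘-intertwined : ∀ {P Q : Hom A A} {P' Q' : Hom B B} →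
                  Intertwined P P' → Intertwined Q Q' → Intertwined (P ∘ Q) (P' ∘ Q')
  ∘-intertwined {P} {Q} {P'} {Q'} natP natQ = begin
    f ∘ (P ∘ Q)      ≡⟨ sym (assoc f P Q) ⟩
    (f ∘ P) ∘ Q      ≡⟨ cong (_∘ Q) natP ⟩
    (P' ∘ f) ∘ Q     ≡⟨ assoc P' f Q ⟩
    P' ∘ (f ∘ Q)     ≡⟨ cong (P' ∘_) natQ ⟩
    P' ∘ (Q' ∘ f)    ≡⟨ sym (assoc P' Q' f) ⟩
    (P' ∘ Q') ∘ f    ∎

  composeFrom-intertwined : ∀ {M N : Mon ι} (q : Mon.Carrier M → Mon.Carrier N)
    (surj : Surjective q) {P : Mon.Carrier N → Hom A A} {P' : Mon.Carrier N → Hom B B} →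
    (∀ n → Intertwined (P n) (P' n)) →
    ∀ n ns → Intertwined (composeFrom K {M} {N} q surj P n ns) (composeFrom K {M} {N} q surj P' n ns)
  composeFrom-intertwined q surj nat n []       = nat n
  composeFrom-intertwined {M} {N} q surj nat n (m ∷ ms) =
    ∘-intertwined (nat n) (composeFrom-intertwined {M} {N} q surj nat m ms)

module SigmaNaturality {o h r ι j : Level} (K : OrderCat o h r ι)
                       (J : WideSubcategory K j)
                       (JL : JLeftDistributive K J) (JR : JRightDistributive K J)
                       {M N : Mon ι} (q : Mon.Carrier M → Mon.Carrier N)
                       (surj : Surjective q) (π π' : LaxFunctor K M)
                       (f : OrderCat.Hom K (LaxFunctor.obj π) (LaxFunctor.obj π'))
                       (f∈J : WideSubcategory.InJ J f)
                       (natural : ∀ m → OrderCat._∘_ K f (LaxFunctor.act π m)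
                                      ≡ OrderCat._∘_ K (LaxFunctor.act π' m) f) where
  open Intertwining K J JL JR f f∈J

  Π-intertwined : ∀ i n → Intertwined (Π K {M} {N} q surj π i n) (Π K {M} {N} q surj π' i n)
  Π-intertwined zero    n = ⋁-intertwined (surj n) (λ (m , _) → natural m)
  Π-intertwined (suc i) n = ⋁-intertwined _
    (λ { ((n₁ ∷ ns) , _) → composeFrom-intertwined {M} {N} q surj (Π-intertwined i) n₁ ns })

  Σq-intertwined : ∀ n → Intertwined (Σq K {M} {N} q surj π n) (Σq K {M} {N} q surj π' n)
  Σq-intertwined n = ⋁-intertwined _ (λ i → Π-intertwined (lower i) n)

proposition4p6 : ∀ {o h r ι j : Level} (K : OrderCat o h r ι) (J : WideSubcategory K j) →
    LeftDistributive K → JLeftDistributive K J → JRightDistributive K J →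
    (M N : Mon ι) (q : Mon.Carrier M → Mon.Carrier N) →
    IsMonoidHom M N q → (surj : Surjective q) →
    (π π' : LaxFunctor K M) →
    (f : OrderCat.Hom K (LaxFunctor.obj π) (LaxFunctor.obj π')) →
    WideSubcategory.InJ J f →
    (∀ m → OrderCat._∘_ K f (LaxFunctor.act π m) ≡ OrderCat._∘_ K (LaxFunctor.act π' m) f) →
    ∀ n → OrderCat._∘_ K f (Σq K {M} {N} q surj π n) ≡ OrderCat._∘_ K (Σq K {M} {N} q surj π' n) f
proposition4p6 K J _ JL JR M N q _ surj π π' f f∈J natural =
  SigmaNaturality.Σq-intertwined K J JL JR {M} {N} q surj π π' f f∈J natural
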